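{- Let $\alpha, \beta, \delta, \gamma > 0$ be real numbers satisfying $$\beta > \tfrac{1}{2},\qquad \delta > \max\left\{ \tfrac{\beta(1-\beta)}{3} + \gamma\alpha,\ \tfrac{(1-\gamma)^2}{12} + \gamma\alpha,\ \tfrac{1}{12}\right\},$$ $$\delta > \tfrac{1}{2}\max\left\{ \tfrac{(2-2\beta)^2}{4} + (2\beta - 1)\gamma,\ \tfrac{\beta^2}{4} + (1-\beta)\gamma\right\}.$$ Let $\mathcal{H}$ be an $n$-vertex $\{K_4^{3- }, F_5\}$-free $3$-graph with $\alpha(\mathcal{H}) \le \alpha n$ and $\delta(\mathcal{H}) > \delta n^2$, and suppose $\mathcal{H}$ contains three pairwise disjoint independent sets $U_1, U_2, U_3 \subseteq V(\mathcal{H})$ such that (i) $|U_i| + |U_j| > \beta n$ for every pair $\{i,j\}$ of distinct indices in $\{1,2,3\}$, and (ii) $|U_1| + |U_2| + |U_3| > (1-\gamma) n$. Then $\mathcal{H}$ is $3$-partite.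
   Context: A $3$-graph is a collection $\mathcal{H}$ of $3$-element subsets (edges) of a finite vertex set $V(\mathcal{H})$; $\delta(\mathcal{H})$ is its minimum vertex degree. $K_4^{3- }$ is the $3$-graph with edges $\{abc, abd, acd\}$ and $F_5$ is the $3$-graph with edges $\{abc,abd,cde\}$; $\{K_4^{3- },F_5\}$-free means containing no copy of either. A set $I \subseteq V(\mathcal{H})$ is independent in $\mathcal{H}$ if every edge of $\mathcal{H}$ contains at most one vertex of $I$, and $\alpha(\mathcal{H})$ is the maximum size of an independent set. $\mathcal{H}$ is $3$-partite if $V(\mathcal{H})$ can be partitioned into three sets such that every edge contains exactly one vertex from each set.
   Formalization: The parameters α, β, δ, γ range over the positive rationals rather than the positive real numbers. -}

module Defs where

open import Data.Bool using (Bool; true; false; if_then_else_; _∧_)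
open import Data.Nat as ℕ using (ℕ; zero; suc)
open import Data.Fin using (Fin; toℕ)
open import Data.List using (List; []; _∷_; map; allFin)
open import Data.Nat.ListAction using (sum)
open import Data.List.Relation.Unary.Unique.Propositional using (Unique)
open import Data.Integer using (+_)
open import Data.Rational using (ℚ; _/_)
open import Data.Product using (Σ; _×_; ∃-syntax)
open import Data.Empty using (⊥)
open import Relation.Nullary using (¬_)
open import Relation.Binary.PropositionalEquality using (_≡_; _≢_)

-- A 3-graph on vertex set Fin n: a symmetric indicator of 3-element
-- subsets {x,y,z}, given on ordered triples of distinct vertices.
record 3Graph (n : ℕ) : Set where
  field
    E        : Fin n → Fin n → Fin n → Bool
    distinct : ∀ x y z → E x y z ≡ true → (x ≢ y) × (y ≢ z) × (x ≢ z)
    sym₁₂    : ∀ x y z → E x y z ≡ E y x z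
    sym₂₃    : ∀ x y z → E x y z ≡ E x z y
open 3Graph public

count : ∀ {n} → (Fin n → Bool) → ℕ
count {n} p = sum (map (λ u → if p u then 1 else 0) (allFin n))

degree : ∀ {n} → 3Graph n → Fin n → ℕ
degree H v = sum (map (λ u → count (λ w → if toℕ u ℕ.<ᵇ toℕ w then E H v u w else false)) (allFin _))

ContainsK4⁻ : ∀ {n} → 3Graph n → Set
ContainsK4⁻ {n} H = ∃[ a ] ∃[ b ] ∃[ c ] ∃[ d ]
  (Unique (a ∷ b ∷ c ∷ d ∷ []) × E H a b c ≡ true × E H a b d ≡ true × E H a c d ≡ true)

ContainsF5 : ∀ {n} → 3Graph n → Set
ContainsF5 {n} H = ∃[ a ] ∃[ b ] ∃[ c ] ∃[ d ] ∃[ e ]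
  (Unique (a ∷ b ∷ c ∷ d ∷ e ∷ []) × E H a b c ≡ true × E H a b d ≡ true × E H c d e ≡ true)

Independent : ∀ {n} → 3Graph n → (Fin n → Bool) → Set
Independent H I = ∀ x y z → E H x y z ≡ true → I x ≡ true → I y ≡ true → ⊥

Disjoint : ∀ {n} → (Fin n → Bool) → (Fin n → Bool) → Set
Disjoint A B = ∀ v → A v ≡ true → B v ≡ true → ⊥

ThreePartite : ∀ {n} → 3Graph n → Set
ThreePartite {n} H = Σ (Fin n → Fin 3) λ part → ∀ x y z → E H x y z ≡ true →
  (part x ≢ part y) × (part y ≢ part z) × (part x ≢ part z)

ℕ→ℚ : ℕ → ℚ
ℕ→ℚ k = + k / 1

module Submission where

-- The three independent sets are extended greedily to a proper 3-colouring, one uncoloured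
-- vertex v at a time: v can join colour class i unless some edge contains v and a vertex of
-- class i.  Suppose v meets all three classes, through witnesses w₀, w₁, w₂ (wᵢ of colour i).
-- A pair of differently coloured vertices then lies in the link of at most one of v, w₀, w₁, w₂:
-- not in the links of the witnesses of its own two colours (the classes are independent), and
-- not in those of both v and the third witness, since in a {K₄⁻, F₅}-free graph two vertices of a
-- common edge have edge-disjoint links.  Counting ordered pairs in links, and bounding those that
-- meet one of the μ uncoloured vertices by the maximum codegree (at most αn, as common
-- neighbourhoods are independent), gives
--   8δn² < 2(d(v) + d(w₀) + d(w₁) + d(w₂)) ≤ 2 Σ_{i<j} σᵢσⱼ + 8μαn ≤ (2/3)(n − μ)² + 8μαn,
-- where σᵢ are the class sizes.  The right-hand side is convex in μ, and 0 ≤ μ < γn; at the two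
-- endpoints it is below 8δn² because δ > 1/12 and δ > (1 − γ)²/12 + γα.

open import Defs
open import Data.Bool using (Bool; true; false; if_then_else_; _∧_)
open import Data.Fin using (Fin; zero; suc)
open import Data.Fin.Patterns using (0F; 1F; 2F)
open import Data.Maybe using (Maybe; just; nothing; is-just; is-nothing)
open import Data.Product using (_×_; _,_; proj₁; proj₂; ∃-syntax)
open import Data.Sum using (_⊎_; inj₁; inj₂)
open import Data.Empty using (⊥)
open import Function using (_∘_)
open import Relation.Nullary using (¬_; Dec; yes; no; does; contradiction)
open import Relation.Binary.PropositionalEquality
  using (_≡_; _≢_; refl; sym; trans; cong; cong₂; subst; subst₂; ≢-sym; module ≡-Reasoning)
open import Data.Nat.Properties using (+-*-semiring)
open import Algebra.Properties.Semiring.Sum +-*-semiring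
  using (sum-syntax; sum-cong-≗; sum-replicate-zero; ∑-distrib-+; ∑-comm; *-distribˡ-sum; *-distribʳ-sum)

module FiniteSums where

  open import Data.List using (map; allFin; tabulate)
  open import Data.List.Properties using (map-tabulate)
  open import Data.Nat using (ℕ; zero; suc; _+_; _*_; _≤_; _⊔_; z≤n)
  open import Data.Nat.Properties using (+-mono-≤; +-identityʳ; ≤-refl; ≤-trans; m≤m⊔n; m≤n⊔m; ⊔-sel)
  open import Data.Nat.ListAction using (sum)
  import Data.Fin.Properties as Fin

  𝟙 : Bool → ℕ
  𝟙 b = if b then 1 else 0

  𝟙-mono : ∀ {a b} → (a ≡ true → b ≡ true) → 𝟙 a ≤ 𝟙 b
  𝟙-mono {false} _   = z≤n
  𝟙-mono {true}  a⇒b rewrite a⇒b refl = ≤-refl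

  ∑-mono-≤ : ∀ {m} {f g : Fin m → ℕ} → (∀ i → f i ≤ g i) → ∑[ i < m ] f i ≤ ∑[ i < m ] g i
  ∑-mono-≤ {zero}  f≤g = z≤n
  ∑-mono-≤ {suc m} f≤g = +-mono-≤ (f≤g zero) (∑-mono-≤ (f≤g ∘ suc))

  ∑-one : ∀ m → ∑[ i < m ] 1 ≡ m
  ∑-one zero    = refl
  ∑-one (suc m) = cong suc (∑-one m)

  ∑-single : ∀ {m} {f : Fin m → ℕ} k → (∀ l → l ≢ k → f l ≡ 0) → ∑[ l < m ] f l ≡ f k
  ∑-single {suc m} {f} zero others =
    trans (cong (f zero +_) (trans (sum-cong-≗ (λ l → others (suc l) λ ())) (sum-replicate-zero m)))
          (+-identityʳ (f zero))
  ∑-single {suc m} {f} (suc k) others =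
    trans (cong (_+ ∑[ l < m ] f (suc l)) (others zero λ ()))
          (∑-single k (λ l l≢k → others (suc l) (l≢k ∘ Fin.suc-injective)))

  ∑∑-distrib-+ : ∀ {m} (f g : Fin m → Fin m → ℕ) →
    ∑[ i < m ] ∑[ j < m ] (f i j + g i j) ≡ ∑[ i < m ] ∑[ j < m ] f i j + ∑[ i < m ] ∑[ j < m ] g i j
  ∑∑-distrib-+ {m} f g = trans (sum-cong-≗ (λ i → ∑-distrib-+ (f i) (g i)))
                               (∑-distrib-+ (λ i → ∑[ j < m ] f i j) (λ i → ∑[ j < m ] g i j))

  ∑∑-product : ∀ {m} (f g : Fin m → ℕ) →
    ∑[ i < m ] ∑[ j < m ] (f i * g j) ≡ ∑[ i < m ] f i * ∑[ j < m ] g j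
  ∑∑-product f g = trans (sum-cong-≗ (λ i → sym (*-distribˡ-sum (f i) g))) (sym (*-distribʳ-sum _ f))

  sum-map-allFin : ∀ {m} (f : Fin m → ℕ) → sum (map f (allFin m)) ≡ ∑[ i < m ] f i
  sum-map-allFin f = trans (cong sum (map-tabulate (λ i → i) f)) (sum-tabulate f)
    where
    sum-tabulate : ∀ {k} (f : Fin k → ℕ) → sum (tabulate f) ≡ ∑[ i < k ] f i
    sum-tabulate {zero}  f = refl
    sum-tabulate {suc k} f = cong (f zero +_) (sum-tabulate (f ∘ suc))

  count-mono : ∀ {m} {p q : Fin m → Bool} → (∀ i → p i ≡ true → q i ≡ true) → count p ≤ count q
  count-mono {p = p} {q} p⊆q =
    subst₂ _≤_ (sym (sum-map-allFin (𝟙 ∘ p))) (sym (sum-map-allFin (𝟙 ∘ q))) (∑-mono-≤ (λ i → 𝟙-mono (p⊆q i)))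

  ⨆ : ∀ {m} → (Fin m → ℕ) → ℕ
  ⨆ {zero}  f = 0
  ⨆ {suc m} f = f zero ⊔ ⨆ (f ∘ suc)

  ≤-⨆ : ∀ {m} (f : Fin m → ℕ) i → f i ≤ ⨆ f
  ≤-⨆ f zero    = m≤m⊔n (f zero) _
  ≤-⨆ f (suc i) = ≤-trans (≤-⨆ (f ∘ suc) i) (m≤n⊔m (f zero) _)

  ⨆-preserves : ∀ {m} (P : ℕ → Set) {f : Fin m → ℕ} → P 0 → (∀ i → P (f i)) → P (⨆ f)
  ⨆-preserves {zero}  P P0 Pf = P0
  ⨆-preserves {suc m} P {f} P0 Pf with ⊔-sel (f zero) (⨆ (f ∘ suc))
  ... | inj₁ eq = subst P (sym eq) (Pf zero)
  ... | inj₂ eq = subst P (sym eq) (⨆-preserves P P0 (Pf ∘ suc))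

open FiniteSums

module Edges {n} (H : 3Graph n) {x y z : Fin n} (e : E H x y z ≡ true) where

  swap₁₂ : E H y x z ≡ true
  swap₁₂ = trans (sym (sym₁₂ H x y z)) e

  swap₂₃ : E H x z y ≡ true
  swap₂₃ = trans (sym (sym₂₃ H x y z)) e

  rotate : E H y z x ≡ true
  rotate = trans (sym (sym₂₃ H y x z)) swap₁₂

  rotate⁻¹ : E H z x y ≡ true
  rotate⁻¹ = trans (sym (sym₁₂ H x z y)) swap₂₃

  swap₁₃ : E H z y x ≡ true
  swap₁₃ = trans (sym (sym₁₂ H y z x)) rotate

  ≢₁₂ : x ≢ y
  ≢₁₂ = proj₁ (distinct H x y z e)

  ≢₂₃ : y ≢ z
  ≢₂₃ = proj₁ (proj₂ (distinct H x y z e))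

  ≢₁₃ : x ≢ z
  ≢₁₃ = proj₂ (proj₂ (distinct H x y z e))

module Links {n} (H : 3Graph n) where

  open import Data.Fin using (toℕ)
  open import Data.Fin.Properties using (_≟_)
  open import Data.List using ([]; _∷_)
  open import Data.List.Relation.Unary.All using ([]; _∷_)
  open import Data.List.Relation.Unary.AllPairs using ([]; _∷_)
  open import Data.List.Relation.Unary.Unique.Propositional using (Unique)
  open import Data.Nat using (ℕ; _+_; _≤_; _<ᵇ_; z≤n)
  open import Data.Nat.Properties
    using (≤-reflexive; ≤-trans; +-identityʳ; <-asym; <ᵇ⇒<; module ≤-Reasoning)
  open import Data.Bool using (T)
  open Edges H

  codegree : Fin n → Fin n → ℕ
  codegree x p = count (E H x p)

  maxCodegree : ℕ
  maxCodegree = ⨆ λ x → ⨆ (codegree x)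

  codegree≤max : ∀ x p → codegree x p ≤ maxCodegree
  codegree≤max x p = ≤-trans (≤-⨆ (codegree x) p) (≤-⨆ (λ x → ⨆ (codegree x)) x)

  degree+degree≤ : ∀ x → degree H x + degree H x ≤ ∑[ p < n ] ∑[ q < n ] 𝟙 (E H x p q)
  degree+degree≤ x = begin
    degree H x + degree H x
      ≡⟨ cong₂ _+_ degree≡ (trans degree≡ (∑-comm below)) ⟩
    ∑[ p < n ] ∑[ q < n ] below p q + ∑[ p < n ] ∑[ q < n ] below q p
      ≡⟨ ∑∑-distrib-+ below (λ p q → below q p) ⟨
    ∑[ p < n ] ∑[ q < n ] (below p q + below q p)
      ≤⟨ ∑-mono-≤ (λ p → ∑-mono-≤ (split p)) ⟩
    ∑[ p < n ] ∑[ q < n ] 𝟙 (E H x p q) ∎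
    where
    open ≤-Reasoning
    below : Fin n → Fin n → ℕ
    below p q = 𝟙 (if toℕ p <ᵇ toℕ q then E H x p q else false)
    degree≡ : degree H x ≡ ∑[ p < n ] ∑[ q < n ] below p q
    degree≡ = trans (sum-map-allFin (λ p → count (λ q → if toℕ p <ᵇ toℕ q then E H x p q else false)))
                    (sum-cong-≗ (λ p → sum-map-allFin (below p)))
    split : ∀ p q → below p q + below q p ≤ 𝟙 (E H x p q)
    split p q with toℕ p <ᵇ toℕ q in p<q | toℕ q <ᵇ toℕ p in q<p
    ... | true  | true  = contradiction (<ᵇ⇒< (toℕ q) (toℕ p) (subst T (sym q<p) _))
                                        (<-asym (<ᵇ⇒< (toℕ p) (toℕ q) (subst T (sym p<q) _)))
    ... | true  | false = ≤-reflexive (+-identityʳ _)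
    ... | false | true  = ≤-reflexive (cong 𝟙 (sym₂₃ H x q p))
    ... | false | false = z≤n

  module _ (K4⁻-free : ¬ ContainsK4⁻ H) (F5-free : ¬ ContainsF5 H) where

    private
      unique₄ : ∀ {a b c d : Fin n} → a ≢ b → a ≢ c → a ≢ d → b ≢ c → b ≢ d → c ≢ d →
                Unique (a ∷ b ∷ c ∷ d ∷ [])
      unique₄ ab ac ad bc bd cd = (ab ∷ ac ∷ ad ∷ []) ∷ (bc ∷ bd ∷ []) ∷ (cd ∷ []) ∷ [] ∷ []

      unique₅ : ∀ {a b c d e : Fin n} → a ≢ b → a ≢ c → a ≢ d → a ≢ e → b ≢ c → b ≢ d → b ≢ e →
                c ≢ d → c ≢ e → d ≢ e → Unique (a ∷ b ∷ c ∷ d ∷ e ∷ [])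
      unique₅ ab ac ad ae bc bd be cd ce de =
        (ab ∷ ac ∷ ad ∷ ae ∷ []) ∷ (bc ∷ bd ∷ be ∷ []) ∷ (cd ∷ ce ∷ []) ∷ (de ∷ []) ∷ [] ∷ []

    -- An edge xyz inside the common neighbourhood of u and w spans a K₄⁻ with u and w if z ∈ {u, w},
    -- and an F₅ {uwx, uwy, xyz} otherwise.
    common-neighbourhood-independent : ∀ u w → Independent H (E H u w)
    common-neighbourhood-independent u w x y z xyz uwx uwy with z ≟ u | z ≟ w
    ... | yes refl | _ = K4⁻-free (z , w , x , y ,
          unique₄ (≢₁₂ uwx) (≢₁₃ uwx) (≢₁₃ uwy) (≢₂₃ uwx) (≢₂₃ uwy) (≢₁₂ xyz) ,
          uwx , uwy , rotate⁻¹ xyz)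
    ... | no _ | yes refl = K4⁻-free (z , u , x , y ,
          unique₄ (≢-sym (≢₁₂ uwx)) (≢₂₃ uwx) (≢₂₃ uwy) (≢₁₃ uwx) (≢₁₃ uwy) (≢₁₂ xyz) ,
          swap₁₂ uwx , swap₁₂ uwy , rotate⁻¹ xyz)
    ... | no z≢u | no z≢w = F5-free (u , w , x , y , z ,
          unique₅ (≢₁₂ uwx) (≢₁₃ uwx) (≢₁₃ uwy) (≢-sym z≢u) (≢₂₃ uwx) (≢₂₃ uwy) (≢-sym z≢w)
                  (≢₁₂ xyz) (≢₁₃ xyz) (≢₂₃ xyz) ,
          uwx , uwy , xyz)

    -- If u' ∈ {p, q} the four vertices u, v, p, q span a K₄⁻; otherwise {pqv, pqu, vuu'} is an F₅.
    links-disjoint : ∀ {v u u' p q} → E H v u u' ≡ true → E H v p q ≡ true → E H u p q ≡ true → ⊥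
    links-disjoint {v} {u} {u'} {p} {q} vuu' vpq upq with u' ≟ p | u' ≟ q
    ... | yes refl | _ = K4⁻-free (u' , v , q , u ,
          unique₄ (≢-sym (≢₁₂ vpq)) (≢₂₃ vpq) (≢-sym (≢₁₂ upq)) (≢₁₃ vpq) (≢₁₂ vuu')
                  (≢-sym (≢₁₃ upq)) ,
          swap₁₂ vpq , rotate⁻¹ vuu' , rotate upq)
    ... | no _ | yes refl = K4⁻-free (u' , v , p , u ,
          unique₄ (≢-sym (≢₁₃ vpq)) (≢-sym (≢₂₃ vpq)) (≢-sym (≢₁₃ upq)) (≢₁₂ vpq) (≢₁₂ vuu')
                  (≢-sym (≢₁₂ upq)) ,
          rotate⁻¹ vpq , rotate⁻¹ vuu' , swap₁₃ upq)
    ... | no u'≢p | no u'≢q = F5-free (p , q , v , u , u' ,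
          unique₅ (≢₂₃ vpq) (≢-sym (≢₁₂ vpq)) (≢-sym (≢₁₂ upq)) (≢-sym u'≢p) (≢-sym (≢₁₃ vpq))
                  (≢-sym (≢₁₃ upq)) (≢-sym u'≢q) (≢₁₂ vuu') (≢₁₃ vuu') (≢₂₃ vuu') ,
          rotate vpq , rotate upq , vuu')

open Links

module PartialColourings where

  open import Data.Fin.Properties using (_≟_)
  open import Data.Maybe.Properties using (just-injective)
  open import Data.Nat using (ℕ; _+_; _*_; _≤_)
  open import Relation.Nullary.Decidable using (dec-true)
  open import Data.Bool.Properties using (¬-not)

  Colouring : ℕ → Set
  Colouring n = Fin n → Maybe (Fin 3)

  hasColour : Fin 3 → Maybe (Fin 3) → Bool
  hasColour i (just j) = does (j ≟ i)
  hasColour i nothing  = false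

  hasColour⇒≡just : ∀ {i} m → hasColour i m ≡ true → m ≡ just i
  hasColour⇒≡just {i} (just j) eq with j ≟ i
  ... | yes refl = refl

  ≡just⇒hasColour : ∀ {i m} → m ≡ just i → hasColour i m ≡ true
  ≡just⇒hasColour {i} refl = dec-true (i ≟ i) refl

  classSize : ∀ {n} → Colouring n → Fin 3 → ℕ
  classSize c i = count (λ u → hasColour i (c u))

  uncoloured : ∀ {n} → Colouring n → ℕ
  uncoloured c = count (λ u → is-nothing (c u))

  classSize≡∑ : ∀ {n} (c : Colouring n) i → classSize c i ≡ ∑[ u < n ] 𝟙 (hasColour i (c u))
  classSize≡∑ c i = sum-map-allFin (λ u → 𝟙 (hasColour i (c u)))

  uncoloured≡∑ : ∀ {n} (c : Colouring n) → uncoloured c ≡ ∑[ u < n ] 𝟙 (is-nothing (c u))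
  uncoloured≡∑ c = sum-map-allFin (λ u → 𝟙 (is-nothing (c u)))

  classSize-⊇ : ∀ {n} {c : Colouring n} {U : Fin n → Bool} i → (∀ u → U u ≡ true → c u ≡ just i) →
                count U ≤ classSize c i
  classSize-⊇ i U⇒i = count-mono (λ u u∈U → ≡just⇒hasColour (U⇒i u u∈U))

  n≡classSizes+uncoloured : ∀ {n} (c : Colouring n) →
    n ≡ classSize c 0F + classSize c 1F + classSize c 2F + uncoloured c
  n≡classSizes+uncoloured {n} c = begin
    n                                           ≡⟨ ∑-one n ⟨
    ∑[ u < n ] 1                                ≡⟨ sum-cong-≗ (λ u → partition (c u)) ⟩
    ∑[ u < n ] (C 0F u + C 1F u + C 2F u + U u)
      ≡⟨ trans (∑-distrib-+ _ U) (cong (_+ ∑U) (trans (∑-distrib-+ _ (C 2F))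
                                                      (cong (_+ ∑C 2F) (∑-distrib-+ (C 0F) (C 1F))))) ⟩
    ∑C 0F + ∑C 1F + ∑C 2F + ∑U
      ≡⟨ cong₂ _+_ (cong₂ _+_ (cong₂ _+_ (classSize≡∑ c 0F) (classSize≡∑ c 1F)) (classSize≡∑ c 2F))
                   (uncoloured≡∑ c) ⟨
    classSize c 0F + classSize c 1F + classSize c 2F + uncoloured c ∎
    where
    open ≡-Reasoning
    C : Fin 3 → Fin n → ℕ
    C i u = 𝟙 (hasColour i (c u))
    U : Fin n → ℕ
    U u = 𝟙 (is-nothing (c u))
    ∑C : Fin 3 → ℕ
    ∑C i = ∑[ u < n ] C i u
    ∑U : ℕ
    ∑U = ∑[ u < n ] U u
    partition : ∀ m →
      1 ≡ 𝟙 (hasColour 0F m) + 𝟙 (hasColour 1F m) + 𝟙 (hasColour 2F m) + 𝟙 (is-nothing m)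
    partition nothing   = refl
    partition (just 0F) = refl
    partition (just 1F) = refl
    partition (just 2F) = refl

  -- The indicator of two distinct colours, written as a sum of products so that its double sum
  -- over a colouring factorises into class sizes.
  bichromatic : Maybe (Fin 3) → Maybe (Fin 3) → ℕ
  bichromatic m m' = χ 0F m * (χ 1F m' + χ 2F m') + χ 1F m * (χ 0F m' + χ 2F m')
                   + χ 2F m * (χ 0F m' + χ 1F m')
    where
    χ : Fin 3 → Maybe (Fin 3) → ℕ
    χ i m = 𝟙 (hasColour i m)

  bichromaticPairs : ∀ {n} → Colouring n → ℕ
  bichromaticPairs c = classSize c 0F * (classSize c 1F + classSize c 2F)
                     + classSize c 1F * (classSize c 0F + classSize c 2F)
                     + classSize c 2F * (classSize c 0F + classSize c 1F)

  ∑∑bichromatic : ∀ {n} (c : Colouring n) →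
    ∑[ p < n ] ∑[ q < n ] bichromatic (c p) (c q) ≡ bichromaticPairs c
  ∑∑bichromatic {n} c =
    trans (∑∑-distrib-+ (λ p q → term 0F 1F 2F p q + term 1F 0F 2F p q) (term 2F 0F 1F))
          (cong₂ _+_ (trans (∑∑-distrib-+ (term 0F 1F 2F) (term 1F 0F 2F))
                            (cong₂ _+_ (∑∑term 0F 1F 2F) (∑∑term 1F 0F 2F)))
                     (∑∑term 2F 0F 1F))
    where
    C : Fin 3 → Fin n → ℕ
    C i u = 𝟙 (hasColour i (c u))
    term : Fin 3 → Fin 3 → Fin 3 → Fin n → Fin n → ℕ
    term i j k p q = C i p * (C j q + C k q)
    ∑∑term : ∀ i j k →
      ∑[ p < n ] ∑[ q < n ] term i j k p q ≡ classSize c i * (classSize c j + classSize c k)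
    ∑∑term i j k = begin
      ∑[ p < n ] ∑[ q < n ] term i j k p q
        ≡⟨ ∑∑-product (C i) (λ q → C j q + C k q) ⟩
      ∑[ p < n ] C i p * ∑[ q < n ] (C j q + C k q)
        ≡⟨ cong₂ _*_ (classSize≡∑ c i) (trans (cong₂ _+_ (classSize≡∑ c j) (classSize≡∑ c k))
                                              (sym (∑-distrib-+ (C j) (C k)))) ⟨
      classSize c i * (classSize c j + classSize c k) ∎
      where open ≡-Reasoning

  _⊑_ : ∀ {n} → Colouring n → Colouring n → Set
  c ⊑ c' = ∀ {u i} → c u ≡ just i → c' u ≡ just i

  IsColoured : ∀ {n} → Colouring n → Fin n → Set
  IsColoured c u = ∃[ i ] c u ≡ just i

  classSize-mono : ∀ {n} {c c' : Colouring n} → c ⊑ c' → ∀ i → classSize c i ≤ classSize c' i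
  classSize-mono {c = c} c⊑c' i = classSize-⊇ i (λ u u∈ → c⊑c' (hasColour⇒≡just (c u) u∈))

  recolour : ∀ {n} → Colouring n → Fin n → Fin 3 → Colouring n
  recolour c v i u with u ≟ v
  ... | yes _ = just i
  ... | no  _ = c u

  recolour-at : ∀ {n} (c : Colouring n) v i → recolour c v i v ≡ just i
  recolour-at c v i with v ≟ v
  ... | yes _   = refl
  ... | no  v≢v = contradiction refl v≢v

  recolour-inv : ∀ {n} {c : Colouring n} {v i u j} →
    recolour c v i u ≡ just j → (u ≡ v × i ≡ j) ⊎ c u ≡ just j
  recolour-inv {v = v} {u = u} eq with u ≟ v
  ... | yes u≡v = inj₁ (u≡v , just-injective eq)
  ... | no  _   = inj₂ eq

  recolour-extends : ∀ {n} {c : Colouring n} {v} i → c v ≡ nothing → c ⊑ recolour c v i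
  recolour-extends {v = v} i cv≡nothing {u} cu≡just with u ≟ v
  ... | yes refl = contradiction (trans (sym cv≡nothing) cu≡just) λ ()
  ... | no  _    = cu≡just

  fromClasses : ∀ {n} → (Fin 3 → Fin n → Bool) → Colouring n
  fromClasses U u = if U 0F u then just 0F else if U 1F u then just 1F else if U 2F u then just 2F else nothing

  fromClasses-sound : ∀ {n} (U : Fin 3 → Fin n → Bool) {u i} →
    fromClasses U u ≡ just i → U i u ≡ true
  fromClasses-sound U {u} with U 0F u in u∈₀ | U 1F u in u∈₁ | U 2F u in u∈₂
  ... | true  | _     | _     = λ { refl → u∈₀ }
  ... | false | true  | _     = λ { refl → u∈₁ }
  ... | false | false | true  = λ { refl → u∈₂ }
  ... | false | false | false = λ ()

  fromClasses-complete : ∀ {n} (U : Fin 3 → Fin n → Bool) →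
    Disjoint (U 0F) (U 1F) → Disjoint (U 0F) (U 2F) → Disjoint (U 1F) (U 2F) →
    ∀ i {u} → U i u ≡ true → fromClasses U u ≡ just i
  fromClasses-complete U _ _ _ 0F u∈ rewrite u∈ = refl
  fromClasses-complete U d₀₁ _ _ 1F {u} u∈
    rewrite ¬-not {U 0F u} (λ u∈₀ → d₀₁ u u∈₀ u∈) | u∈ = refl
  fromClasses-complete U _ d₀₂ d₁₂ 2F {u} u∈
    rewrite ¬-not {U 0F u} (λ u∈₀ → d₀₂ u u∈₀ u∈) | ¬-not {U 1F u} (λ u∈₁ → d₁₂ u u∈₁ u∈) | u∈
    = refl

  module _ {n} (H : 3Graph n) where

    open Edges H

    Proper : Colouring n → Set
    Proper c = ∀ {x y z i} → E H x y z ≡ true → c x ≡ just i → c y ≡ just i → ⊥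

    Sees : Colouring n → Fin n → Fin 3 → Set
    Sees c v i = ∃[ u ] ∃[ u' ] c u ≡ just i × E H v u u' ≡ true

    recolour-proper : ∀ {c v i} → Proper c → ¬ Sees c v i → Proper (recolour c v i)
    recolour-proper {c} {v} {i} proper unseen {x} {y} {z} e x↦j y↦j
      with recolour-inv {c = c} {v} {i} {x} x↦j | recolour-inv {c = c} {v} {i} {y} y↦j
    ... | inj₁ (refl , _)    | inj₁ (refl , _)    = ≢₁₂ e refl
    ... | inj₁ (refl , refl) | inj₂ cy            = unseen (y , z , cy , e)
    ... | inj₂ cx            | inj₁ (refl , refl) = unseen (x , z , cx , swap₁₂ e)
    ... | inj₂ cx            | inj₂ cy            = proper e cx cy

    fromClasses-proper : ∀ U → (∀ i → Independent H (U i)) → Proper (fromClasses U)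
    fromClasses-proper U independent e cx cy =
      independent _ _ _ _ e (fromClasses-sound U cx) (fromClasses-sound U cy)

    proper-total⇒ThreePartite : ∀ {c} → Proper c → (∀ u → IsColoured c u) → ThreePartite H
    proper-total⇒ThreePartite {c} proper coloured =
      colour , λ x y z e → separated e , separated (rotate e) , separated (swap₂₃ e)
      where
      colour : Fin n → Fin 3
      colour u = proj₁ (coloured u)
      separated : ∀ {x y z} → E H x y z ≡ true → colour x ≢ colour y
      separated {x} {y} e same =
        proper e (proj₂ (coloured x)) (subst (λ i → c y ≡ just i) (sym same) (proj₂ (coloured y)))

open PartialColourings

module LinkCounting {n} (H : 3Graph n) where

  open import Data.Nat using (ℕ; _+_; _*_; _≤_; z≤n; s≤s)
  open import Data.Nat.Properties
    using (≤-refl; ≤-reflexive; +-mono-≤; +-monoʳ-≤; +-monoˡ-≤; *-monoʳ-≤; +-assoc; module ≤-Reasoning)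
  open import Data.Nat.Solver using (module +-*-Solver)
  open import Data.Bool.Properties using (¬-not)

  seen : Colouring n → Fin n → Fin n → Fin n → ℕ
  seen c x p q = 𝟙 (is-just (c p) ∧ (is-just (c q) ∧ E H x p q))

  colouredLinks : Colouring n → Fin n → ℕ
  colouredLinks c x = ∑[ p < n ] ∑[ q < n ] seen c x p q

  uncolouredLinks≤ : ∀ c x → ∑[ p < n ] ∑[ q < n ] (𝟙 (is-nothing (c p)) * 𝟙 (E H x p q))
                               ≤ uncoloured c * maxCodegree H
  uncolouredLinks≤ c x = begin
    ∑[ p < n ] ∑[ q < n ] (U p * 𝟙 (E H x p q))
      ≡⟨ sum-cong-≗ (λ p → *-distribˡ-sum (U p) (λ q → 𝟙 (E H x p q))) ⟨
    ∑[ p < n ] (U p * ∑[ q < n ] 𝟙 (E H x p q))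
      ≡⟨ sum-cong-≗ (λ p → cong (U p *_) (sum-map-allFin (λ q → 𝟙 (E H x p q)))) ⟨
    ∑[ p < n ] (U p * codegree H x p)
      ≤⟨ ∑-mono-≤ (λ p → *-monoʳ-≤ (U p) (codegree≤max H x p)) ⟩
    ∑[ p < n ] (U p * maxCodegree H)
      ≡⟨ *-distribʳ-sum (maxCodegree H) U ⟨
    ∑[ p < n ] U p * maxCodegree H
      ≡⟨ cong (_* maxCodegree H) (uncoloured≡∑ c) ⟨
    uncoloured c * maxCodegree H ∎
    where
    open ≤-Reasoning
    U : Fin n → ℕ
    U p = 𝟙 (is-nothing (c p))

  degree+degree≤colouredLinks : ∀ c x →
    degree H x + degree H x ≤ colouredLinks c x + (uncoloured c * maxCodegree H + uncoloured c * maxCodegree H)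
  degree+degree≤colouredLinks c x = begin
    degree H x + degree H x
      ≤⟨ degree+degree≤ H x ⟩
    ∑[ p < n ] ∑[ q < n ] 𝟙 (E H x p q)
      ≤⟨ ∑-mono-≤ (λ p → ∑-mono-≤ (λ q → split (c p) (c q) (E H x p q))) ⟩
    ∑[ p < n ] ∑[ q < n ] (seen c x p q + first p q + second p q)
      ≡⟨ trans (∑∑-distrib-+ _ second) (cong (_+ ∑∑ second) (∑∑-distrib-+ (seen c x) first)) ⟩
    colouredLinks c x + ∑∑ first + ∑∑ second
      ≡⟨ cong (colouredLinks c x + ∑∑ first +_) second≡first ⟩
    colouredLinks c x + ∑∑ first + ∑∑ first
      ≤⟨ +-mono-≤ (+-monoʳ-≤ (colouredLinks c x) (uncolouredLinks≤ c x)) (uncolouredLinks≤ c x) ⟩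
    colouredLinks c x + uncoloured c * maxCodegree H + uncoloured c * maxCodegree H
      ≡⟨ +-assoc (colouredLinks c x) _ _ ⟩
    colouredLinks c x + (uncoloured c * maxCodegree H + uncoloured c * maxCodegree H) ∎
    where
    open ≤-Reasoning
    ∑∑ : (Fin n → Fin n → ℕ) → ℕ
    ∑∑ f = ∑[ p < n ] ∑[ q < n ] f p q
    first second : Fin n → Fin n → ℕ
    first  p q = 𝟙 (is-nothing (c p)) * 𝟙 (E H x p q)
    second p q = 𝟙 (is-nothing (c q)) * 𝟙 (E H x p q)
    second≡first : ∑∑ second ≡ ∑∑ first
    second≡first = trans (∑-comm second)
      (sum-cong-≗ (λ q → sum-cong-≗ (λ p → cong (λ b → 𝟙 (is-nothing (c q)) * 𝟙 b) (sym₂₃ H x p q))))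
    split : ∀ m m' b →
      𝟙 b ≤ 𝟙 (is-just m ∧ (is-just m' ∧ b)) + 𝟙 (is-nothing m) * 𝟙 b + 𝟙 (is-nothing m') * 𝟙 b
    split _        _        false = z≤n
    split nothing  _        true  = s≤s z≤n
    split (just _) nothing  true  = s≤s z≤n
    split (just _) (just _) true  = s≤s z≤n

  module Witnesses (K4⁻-free : ¬ ContainsK4⁻ H) (F5-free : ¬ ContainsF5 H)
                   {c : Colouring n} (proper : Proper H c) {v : Fin n} {w w' : Fin 3 → Fin n}
                   (w-colour : ∀ i → c (w i) ≡ just i) (w-edge : ∀ i → E H v (w i) (w' i) ≡ true) where

    open Edges H

    monochromatic : ∀ {p q i} → c p ≡ just i → c q ≡ just i → ∀ x → E H x p q ≡ false
    monochromatic cp cq x = ¬-not (λ e → proper (rotate e) cp cq)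

    blind : ∀ {p q} i → c p ≡ just i ⊎ c q ≡ just i → E H (w i) p q ≡ false
    blind i (inj₁ cp) = ¬-not (λ e → proper e (w-colour i) cp)
    blind i (inj₂ cq) = ¬-not (λ e → proper (swap₂₃ e) (w-colour i) cq)

    monochromatic-bound : ∀ {p q i} → c p ≡ just i → c q ≡ just i →
      𝟙 (E H v p q) + ∑[ l < 3 ] 𝟙 (E H (w l) p q) ≤ 0
    monochromatic-bound {p} {q} cp cq =
      ≤-reflexive (cong₂ _+_ (none v) (trans (sum-cong-≗ (none ∘ w)) (sum-replicate-zero 3)))
      where
      none : ∀ x → 𝟙 (E H x p q) ≡ 0
      none x = cong 𝟙 (monochromatic cp cq x)

    exclusive : ∀ {a b} → (a ≡ true → b ≡ true → ⊥) → 𝟙 a + 𝟙 b ≤ 1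
    exclusive {false} {false} _   = z≤n
    exclusive {false} {true}  _   = ≤-refl
    exclusive {true}  {false} _   = ≤-refl
    exclusive {true}  {true}  a∧b = contradiction refl (a∧b refl)

    only-third-witness-sees : ∀ {p q} k → (∀ l → l ≢ k → E H (w l) p q ≡ false) →
      𝟙 (E H v p q) + ∑[ l < 3 ] 𝟙 (E H (w l) p q) ≤ 1
    only-third-witness-sees {p} {q} k blind-others = begin
      𝟙 (E H v p q) + ∑[ l < 3 ] 𝟙 (E H (w l) p q)
        ≡⟨ cong (𝟙 (E H v p q) +_) (∑-single k (λ l l≢k → cong 𝟙 (blind-others l l≢k))) ⟩
      𝟙 (E H v p q) + 𝟙 (E H (w k) p q)
        ≤⟨ exclusive (links-disjoint H K4⁻-free F5-free (w-edge k)) ⟩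
      1 ∎
      where open ≤-Reasoning

    -- The summands are spelled out (rather than written with seen) so that c p and c q occur
    -- in the goal and the with below can case on them.
    pair-bound : ∀ p q →
      𝟙 (is-just (c p) ∧ (is-just (c q) ∧ E H v p q))
        + ∑[ l < 3 ] 𝟙 (is-just (c p) ∧ (is-just (c q) ∧ E H (w l) p q))
        ≤ bichromatic (c p) (c q)
    pair-bound p q with c p in cp | c q in cq
    ... | nothing | _       = z≤n
    ... | just _  | nothing = z≤n
    ... | just 0F | just 0F = monochromatic-bound cp cq
    ... | just 1F | just 1F = monochromatic-bound cp cq
    ... | just 2F | just 2F = monochromatic-bound cp cq
    ... | just 0F | just 1F = only-third-witness-sees 2F
          λ { 0F _ → blind 0F (inj₁ cp) ; 1F _ → blind 1F (inj₂ cq) ; 2F 2≢2 → contradiction refl 2≢2 }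
    ... | just 1F | just 0F = only-third-witness-sees 2F
          λ { 0F _ → blind 0F (inj₂ cq) ; 1F _ → blind 1F (inj₁ cp) ; 2F 2≢2 → contradiction refl 2≢2 }
    ... | just 0F | just 2F = only-third-witness-sees 1F
          λ { 0F _ → blind 0F (inj₁ cp) ; 2F _ → blind 2F (inj₂ cq) ; 1F 1≢1 → contradiction refl 1≢1 }
    ... | just 2F | just 0F = only-third-witness-sees 1F
          λ { 0F _ → blind 0F (inj₂ cq) ; 2F _ → blind 2F (inj₁ cp) ; 1F 1≢1 → contradiction refl 1≢1 }
    ... | just 1F | just 2F = only-third-witness-sees 0F
          λ { 1F _ → blind 1F (inj₁ cp) ; 2F _ → blind 2F (inj₂ cq) ; 0F 0≢0 → contradiction refl 0≢0 }
    ... | just 2F | just 1F = only-third-witness-sees 0F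
          λ { 1F _ → blind 1F (inj₂ cq) ; 2F _ → blind 2F (inj₁ cp) ; 0F 0≢0 → contradiction refl 0≢0 }

    witnesses-links : ∑[ l < 3 ] colouredLinks c (w l) ≡ ∑[ p < n ] ∑[ q < n ] ∑[ l < 3 ] seen c (w l) p q
    witnesses-links = trans (∑-comm (λ l p → ∑[ q < n ] seen c (w l) p q))
                            (sum-cong-≗ (λ p → ∑-comm (λ l q → seen c (w l) p q)))

    degree-sum≤ : let D = degree H v + ∑[ l < 3 ] degree H (w l) in
      D + D ≤ bichromaticPairs c + 8 * (uncoloured c * maxCodegree H)
    degree-sum≤ = begin
      D v + ∑[ l < 3 ] D (w l) + (D v + ∑[ l < 3 ] D (w l))
        ≡⟨ solve 2 (λ a s → a :+ s :+ (a :+ s) := (a :+ a) :+ (s :+ s)) refl (D v) (∑[ l < 3 ] D (w l)) ⟩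
      (D v + D v) + (∑[ l < 3 ] D (w l) + ∑[ l < 3 ] D (w l))
        ≡⟨ cong ((D v + D v) +_) (∑-distrib-+ (D ∘ w) (D ∘ w)) ⟨
      (D v + D v) + ∑[ l < 3 ] (D (w l) + D (w l))
        ≤⟨ +-mono-≤ (degree+degree≤colouredLinks c v)
                    (∑-mono-≤ (λ l → degree+degree≤colouredLinks c (w l))) ⟩
      (L v + K) + ∑[ l < 3 ] (L (w l) + K)
        ≡⟨ cong ((L v + K) +_) (∑-distrib-+ (L ∘ w) (λ _ → K)) ⟩
      (L v + K) + (∑[ l < 3 ] L (w l) + (K + (K + (K + 0))))
        ≡⟨ solve 3 (λ a s m → (a :+ (m :+ m)) :+ (s :+ ((m :+ m) :+ ((m :+ m) :+ ((m :+ m) :+ con 0))))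
                               := (a :+ s) :+ con 8 :* m) refl (L v) (∑[ l < 3 ] L (w l)) μΔ ⟩
      L v + ∑[ l < 3 ] L (w l) + 8 * μΔ
        ≡⟨ cong (λ t → L v + t + 8 * μΔ) witnesses-links ⟩
      L v + ∑[ p < n ] ∑[ q < n ] ∑[ l < 3 ] seen c (w l) p q + 8 * μΔ
        ≡⟨ cong (_+ 8 * μΔ) (∑∑-distrib-+ (seen c v) (λ p q → ∑[ l < 3 ] seen c (w l) p q)) ⟨
      ∑[ p < n ] ∑[ q < n ] (seen c v p q + ∑[ l < 3 ] seen c (w l) p q) + 8 * μΔ
        ≤⟨ +-monoˡ-≤ (8 * μΔ) (∑-mono-≤ (λ p → ∑-mono-≤ (pair-bound p))) ⟩
      ∑[ p < n ] ∑[ q < n ] bichromatic (c p) (c q) + 8 * μΔ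
        ≡⟨ cong (_+ 8 * μΔ) (∑∑bichromatic c) ⟩
      bichromaticPairs c + 8 * μΔ ∎
      where
      open ≤-Reasoning
      open +-*-Solver
      D L : Fin n → ℕ
      D = degree H
      L = colouredLinks c
      μΔ K : ℕ
      μΔ = uncoloured c * maxCodegree H
      K = μΔ + μΔ

open LinkCounting

open import Data.Nat as ℕ using (ℕ; zero; suc; z≤n)
open import Data.Integer as ℤ using (+_)
import Data.Integer.Properties as ℤ
import Data.Nat.Coprimality as Coprimality
open import Data.Rational using (ℚ; mkℚ; _<_; _≤_; _+_; _-_; _*_; -_; _⊔_; _/_; 0ℚ; 1ℚ; ½; *≤*;
                                 nonNegative; nonPositive; positive)
open import Data.Rational.Properties
  using (↥p/↧p≡p; /-cong; ≤-reflexive; ≤-trans; <⇒≤; <-≤-trans; ≤-<-trans; <-irrefl; ≤-total; _≤?_;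
         +-mono-≤; +-mono-<-≤; +-monoˡ-<; +-monoˡ-≤; +-identityˡ; +-inverseʳ; *-zeroˡ; *-zeroʳ; *-identityˡ;
         *-distribʳ-+; *-monoˡ-≤-nonNeg; *-monoʳ-<-pos; *-cancelˡ-<-nonNeg; p≤p⊔q; p≤q⊔p;
         positive⁻¹; nonNegative⁻¹; pos*pos⇒pos; nonNeg*nonNeg⇒nonNeg; nonPos*nonPos⇒nonPos;
         module ≤-Reasoning)
open import Data.Rational.Solver using (module +-*-Solver)
open import Relation.Nullary.Decidable using (toWitness)
open +-*-Solver

-- The normal form of ℕ→ℚ k, on which the arithmetic of Data.Rational computes.
private
  ℕ→ℚ≡mkℚ : ∀ k → ℕ→ℚ k ≡ mkℚ (+ k) 0 (Coprimality.sym (Coprimality.1-coprimeTo k))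
  ℕ→ℚ≡mkℚ k = ↥p/↧p≡p _

ℕ→ℚ-+ : ∀ x y → ℕ→ℚ (x ℕ.+ y) ≡ ℕ→ℚ x + ℕ→ℚ y
ℕ→ℚ-+ x y = trans (/-cong (sym (cong₂ ℤ._+_ (ℤ.*-identityʳ (+ x)) (ℤ.*-identityʳ (+ y)))) refl)
                  (sym (cong₂ _+_ (ℕ→ℚ≡mkℚ x) (ℕ→ℚ≡mkℚ y)))

ℕ→ℚ-* : ∀ x y → ℕ→ℚ (x ℕ.* y) ≡ ℕ→ℚ x * ℕ→ℚ y
ℕ→ℚ-* x y = trans (/-cong (ℤ.pos-* x y) refl) (sym (cong₂ _*_ (ℕ→ℚ≡mkℚ x) (ℕ→ℚ≡mkℚ y)))

ℕ→ℚ-mono-≤ : ∀ {x y} → x ℕ.≤ y → ℕ→ℚ x ≤ ℕ→ℚ y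
ℕ→ℚ-mono-≤ {x} {y} x≤y = subst₂ _≤_ (sym (ℕ→ℚ≡mkℚ x)) (sym (ℕ→ℚ≡mkℚ y))
  (*≤* (subst₂ ℤ._≤_ (sym (ℤ.*-identityʳ (+ x))) (sym (ℤ.*-identityʳ (+ y))) (ℤ.+≤+ x≤y)))

ℕ→ℚ-nonNeg : ∀ x → 0ℚ ≤ ℕ→ℚ x
ℕ→ℚ-nonNeg x = ℕ→ℚ-mono-≤ {0} {x} z≤n

ℕ→ℚ-∑-lower : ∀ {m} (f : Fin m → ℕ) {x} → (∀ i → x ≤ ℕ→ℚ (f i)) →
              ℕ→ℚ m * x ≤ ℕ→ℚ (∑[ i < m ] f i)
ℕ→ℚ-∑-lower {zero}  f {x} _   = ≤-reflexive (*-zeroˡ x)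
ℕ→ℚ-∑-lower {suc m} f {x} x≤f = begin
  ℕ→ℚ (suc m) * x
    ≡⟨ cong (_* x) (ℕ→ℚ-+ 1 m) ⟩
  (1ℚ + ℕ→ℚ m) * x
    ≡⟨ trans (*-distribʳ-+ x 1ℚ (ℕ→ℚ m)) (cong (_+ ℕ→ℚ m * x) (*-identityˡ x)) ⟩
  x + ℕ→ℚ m * x
    ≤⟨ +-mono-≤ (x≤f zero) (ℕ→ℚ-∑-lower (f ∘ suc) (x≤f ∘ suc)) ⟩
  ℕ→ℚ (f zero) + ℕ→ℚ (∑[ i < m ] f (suc i))
    ≡⟨ ℕ→ℚ-+ (f zero) (∑[ i < m ] f (suc i)) ⟨
  ℕ→ℚ (∑[ i < suc m ] f i) ∎
  where open ≤-Reasoning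

pairSum : ℚ → ℚ → ℚ → ℚ
pairSum x y z = x * (y + z) + y * (x + z) + z * (x + y)

ℕ→ℚ-pairSum : ∀ a b c → ℕ→ℚ (a ℕ.* (b ℕ.+ c) ℕ.+ b ℕ.* (a ℕ.+ c) ℕ.+ c ℕ.* (a ℕ.+ b))
                         ≡ pairSum (ℕ→ℚ a) (ℕ→ℚ b) (ℕ→ℚ c)
ℕ→ℚ-pairSum a b c = trans (ℕ→ℚ-+ (a ℕ.* (b ℕ.+ c) ℕ.+ b ℕ.* (a ℕ.+ c)) (c ℕ.* (a ℕ.+ b)))
  (cong₂ _+_ (trans (ℕ→ℚ-+ (a ℕ.* (b ℕ.+ c)) (b ℕ.* (a ℕ.+ c))) (cong₂ _+_ (term a b c) (term b a c)))
             (term c a b))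
  where
  term : ∀ x y z → ℕ→ℚ (x ℕ.* (y ℕ.+ z)) ≡ ℕ→ℚ x * (ℕ→ℚ y + ℕ→ℚ z)
  term x y z = trans (ℕ→ℚ-* x (y ℕ.+ z)) (cong (ℕ→ℚ x *_) (ℕ→ℚ-+ y z))

*-positive : ∀ {p q} → 0ℚ < p → 0ℚ < q → 0ℚ < p * q
*-positive {p} {q} 0<p 0<q = positive⁻¹ _ {{pos*pos⇒pos p {{positive 0<p}} q {{positive 0<q}}}}

*-nonNegative : ∀ {p q} → 0ℚ ≤ p → 0ℚ ≤ q → 0ℚ ≤ p * q
*-nonNegative {p} {q} 0≤p 0≤q =
  nonNegative⁻¹ _ {{nonNeg*nonNeg⇒nonNeg p {{nonNegative 0≤p}} q {{nonNegative 0≤q}}}}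

square-nonNegative : ∀ p → 0ℚ ≤ p * p
square-nonNegative p with ≤-total 0ℚ p
... | inj₁ 0≤p = *-nonNegative 0≤p 0≤p
... | inj₂ p≤0 = nonNegative⁻¹ _ {{nonPos*nonPos⇒nonPos p {{nonPositive p≤0}} p {{nonPositive p≤0}}}}

positive-cancelˡ : ∀ {r p} → 0ℚ < r → 0ℚ < r * p → 0ℚ < p
positive-cancelˡ {r} {p} 0<r 0<rp =
  *-cancelˡ-<-nonNeg r {{nonNegative (<⇒≤ 0<r)}} (subst (_< r * p) (sym (*-zeroʳ r)) 0<rp)

p<q⇒0<q-p : ∀ {p q} → p < q → 0ℚ < q - p
p<q⇒0<q-p {p} {q} p<q = subst (_< q - p) (+-inverseʳ p) (+-monoˡ-< (- p) p<q)

q-p+p≡q : ∀ p q → q - p + p ≡ q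
q-p+p≡q = solve 2 (λ p q → q :- p :+ p := q) refl

0<q-p⇒p<q : ∀ {p q} → 0ℚ < q - p → p < q
0<q-p⇒p<q {p} {q} 0<q-p = subst₂ _<_ (+-identityˡ p) (q-p+p≡q p q) (+-monoˡ-< p 0<q-p)

0≤q-p⇒p≤q : ∀ {p q} → 0ℚ ≤ q - p → p ≤ q
0≤q-p⇒p≤q {p} {q} 0≤q-p = subst₂ _≤_ (+-identityˡ p) (q-p+p≡q p q) (+-monoˡ-≤ p 0≤q-p)

pairSum≤⅔square : ∀ x y z → pairSum x y z ≤ + 2 / 3 * ((x + y + z) * (x + y + z))
pairSum≤⅔square x y z =
  0≤q-p⇒p≤q (subst (0ℚ ≤_) (sym gap) (*-nonNegative (toWitness {a? = 0ℚ ≤? + 1 / 3} _) squares))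
  where
  squares : 0ℚ ≤ (x - y) * (x - y) + (x - z) * (x - z) + (y - z) * (y - z)
  squares = +-mono-≤ (+-mono-≤ (square-nonNegative (x - y)) (square-nonNegative (x - z)))
                     (square-nonNegative (y - z))
  gap : + 2 / 3 * ((x + y + z) * (x + y + z)) - pairSum x y z
      ≡ + 1 / 3 * ((x - y) * (x - y) + (x - z) * (x - z) + (y - z) * (y - z))
  gap = solve 3 (λ x y z → con (+ 2 / 3) :* ((x :+ y :+ z) :* (x :+ y :+ z))
                            :- (x :* (y :+ z) :+ y :* (x :+ z) :+ z :* (x :+ y))
                          := con (+ 1 / 3) :* ((x :- y) :* (x :- y) :+ (x :- z) :* (x :- z)
                                               :+ (y :- z) :* (y :- z)))
              refl x y z

-- Convexity in μ ∈ [0, gN): with N = s + μ and G = s − (1 − g)N = gN − μ, the gap times gN is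
-- G·N²·(d − 1/12) + μ·N²·(d − K) + gμGN/12, the gaps at the endpoints μ = 0 and μ = gN weighted
-- by G and μ, plus a convexity term.
convex-quadratic-bound : ∀ {α d g s μ} → 0ℚ < g → 0ℚ ≤ μ → (1ℚ - g) * (s + μ) < s →
  + 1 / 12 < d → ((1ℚ - g) * (1ℚ - g)) * (+ 1 / 12) + g * α < d →
  (s * s) * (+ 1 / 12) + μ * α * (s + μ) < d * ((s + μ) * (s + μ))
convex-quadratic-bound {α} {d} {g} {s} {μ} 0<g 0≤μ large d>1/12 d>K =
  0<q-p⇒p<q (positive-cancelˡ 0<gN (subst (0ℚ <_) (sym certificate) (+-mono-<-≤ main rest)))
  where
  N G K : ℚ
  N = s + μ
  G = s - (1ℚ - g) * N
  K = ((1ℚ - g) * (1ℚ - g)) * (+ 1 / 12) + g * α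
  0<G : 0ℚ < G
  0<G = p<q⇒0<q-p large
  0<gN : 0ℚ < g * N
  0<gN = subst (0ℚ <_) (solve 3 (λ g s μ → s :- (con 1ℚ :- g) :* (s :+ μ) :+ μ := g :* (s :+ μ)) refl g s μ)
               (+-mono-<-≤ 0<G 0≤μ)
  0<N : 0ℚ < N
  0<N = positive-cancelˡ 0<g 0<gN
  main : 0ℚ < G * (N * N) * (d - + 1 / 12)
  main = *-positive (*-positive 0<G (*-positive 0<N 0<N)) (p<q⇒0<q-p d>1/12)
  rest : 0ℚ ≤ μ * (N * N) * (d - K) + (+ 1 / 12) * (g * μ * G * N)
  rest = +-mono-≤ (*-nonNegative (*-nonNegative 0≤μ (square-nonNegative N)) (<⇒≤ (p<q⇒0<q-p d>K)))
                  (*-nonNegative (toWitness {a? = 0ℚ ≤? + 1 / 12} _)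
                    (*-nonNegative (*-nonNegative (*-nonNegative (<⇒≤ 0<g) 0≤μ) (<⇒≤ 0<G)) (<⇒≤ 0<N)))
  certificate : g * N * (d * (N * N) - ((s * s) * (+ 1 / 12) + μ * α * N))
              ≡ G * (N * N) * (d - + 1 / 12) + (μ * (N * N) * (d - K) + (+ 1 / 12) * (g * μ * G * N))
  certificate = solve 5 (λ α d g s μ →
      let N = s :+ μ
          G = s :- (con 1ℚ :- g) :* N
          K = ((con 1ℚ :- g) :* (con 1ℚ :- g)) :* con (+ 1 / 12) :+ g :* α
      in g :* N :* (d :* (N :* N) :- ((s :* s) :* con (+ 1 / 12) :+ μ :* α :* N))
         := G :* (N :* N) :* (d :- con (+ 1 / 12))
            :+ (μ :* (N :* N) :* (d :- K) :+ con (+ 1 / 12) :* (g :* μ :* G :* N)))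
    refl α d g s μ

degree-count-contradiction : ∀ {α d g N σ₀ σ₁ σ₂ μ M D} →
  0ℚ < g → + 1 / 12 < d → ((1ℚ - g) * (1ℚ - g)) * (+ 1 / 12) + g * α < d →
  0ℚ ≤ μ → N ≡ σ₀ + σ₁ + σ₂ + μ → (1ℚ - g) * N < σ₀ + σ₁ + σ₂ → M ≤ α * N →
  + 4 / 1 * (d * (N * N)) ≤ D → D + D ≤ pairSum σ₀ σ₁ σ₂ + + 8 / 1 * (μ * M) → ⊥
degree-count-contradiction {α} {d} {g} {N} {σ₀} {σ₁} {σ₂} {μ} {M} {D}
  0<g d>1/12 d>K 0≤μ refl large M≤αN 4dN²≤D D+D≤ = <-irrefl refl (begin-strict
  + 8 / 1 * dN²
    ≡⟨ solve 1 (λ x → con (+ 8 / 1) :* x := con (+ 4 / 1) :* x :+ con (+ 4 / 1) :* x) refl dN² ⟩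
  + 4 / 1 * dN² + + 4 / 1 * dN²
    ≤⟨ +-mono-≤ 4dN²≤D 4dN²≤D ⟩
  D + D
    ≤⟨ D+D≤ ⟩
  pairSum σ₀ σ₁ σ₂ + + 8 / 1 * (μ * M)
    ≤⟨ +-mono-≤ (pairSum≤⅔square σ₀ σ₁ σ₂)
                (*-monoˡ-≤-nonNeg (+ 8 / 1) (*-monoˡ-≤-nonNeg μ {{nonNegative 0≤μ}} M≤αN)) ⟩
  + 2 / 3 * (s * s) + + 8 / 1 * (μ * (α * N))
    ≡⟨ solve 4 (λ s μ α N → con (+ 2 / 3) :* (s :* s) :+ con (+ 8 / 1) :* (μ :* (α :* N))
                            := con (+ 8 / 1) :* ((s :* s) :* con (+ 1 / 12) :+ μ :* α :* N)) refl s μ α N ⟩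
  + 8 / 1 * ((s * s) * (+ 1 / 12) + μ * α * N)
    <⟨ *-monoʳ-<-pos (+ 8 / 1) (convex-quadratic-bound 0<g 0≤μ large d>1/12 d>K) ⟩
  + 8 / 1 * dN² ∎)
  where
  open ≤-Reasoning
  s dN² : ℚ
  s = σ₀ + σ₁ + σ₂
  dN² = d * (N * N)

module Greedy {n} (H : 3Graph n) (K4⁻-free : ¬ ContainsK4⁻ H) (F5-free : ¬ ContainsF5 H)
  {α d g : ℚ} (0<g : 0ℚ < g) (d>1/12 : + 1 / 12 < d)
  (d>K : ((1ℚ - g) * (1ℚ - g)) * (+ 1 / 12) + g * α < d)
  (α-bound : ∀ I → Independent H I → ℕ→ℚ (count I) ≤ α * ℕ→ℚ n)
  (δ-bound : ∀ v → d * (ℕ→ℚ n * ℕ→ℚ n) < ℕ→ℚ (degree H v)) where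

  open import Data.List using ([]; _∷_; allFin)
  open import Data.List.Membership.Propositional.Properties using (∈-allFin)
  open import Data.List.Relation.Unary.All as All using (All; []; _∷_)
  open import Data.Fin.Properties using (any?; ¬∀⟶∃¬)
  import Data.Fin.Properties as Fin
  import Data.Maybe.Properties as Maybe
  import Data.Bool.Properties as Bool
  import Data.Vec.Functional as Vector
  open import Relation.Nullary.Decidable using (_×-dec_)

  Large : Colouring n → Set
  Large c = (1ℚ - g) * ℕ→ℚ n < ℕ→ℚ (classSize c 0F) + ℕ→ℚ (classSize c 1F) + ℕ→ℚ (classSize c 2F)

  Good : Colouring n → Set
  Good c = Proper H c × Large c

  large-⊇ : ∀ {c} (U : Fin 3 → Fin n → Bool) → (∀ i {u} → U i u ≡ true → c u ≡ just i) →
    (1ℚ - g) * ℕ→ℚ n < ℕ→ℚ (count (U 0F)) + ℕ→ℚ (count (U 1F)) + ℕ→ℚ (count (U 2F)) → Large c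
  large-⊇ {c} U U⇒c large = <-≤-trans large (+-mono-≤ (+-mono-≤ (grow 0F) (grow 1F)) (grow 2F))
    where
    grow : ∀ i → ℕ→ℚ (count (U i)) ≤ ℕ→ℚ (classSize c i)
    grow i = ℕ→ℚ-mono-≤ {count (U i)} {classSize c i} (classSize-⊇ {c = c} {U i} i (λ u → U⇒c i))

  ⊑-large : ∀ {c c'} → c ⊑ c' → Large c → Large c'
  ⊑-large {c} {c'} c⊑c' =
    large-⊇ (λ i u → hasColour i (c u)) (λ i {u} u∈ → c⊑c' (hasColour⇒≡just (c u) u∈))

  maxCodegree≤αn : ℕ→ℚ (maxCodegree H) ≤ α * ℕ→ℚ n
  maxCodegree≤αn = ⨆-preserves P 0≤αn λ x → ⨆-preserves P 0≤αn λ p →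
                     α-bound (E H x p) (common-neighbourhood-independent H K4⁻-free F5-free x p)
    where
    P : ℕ → Set
    P k = ℕ→ℚ k ≤ α * ℕ→ℚ n
    0≤αn : P 0
    0≤αn = ≤-trans (ℕ→ℚ-nonNeg (count {n} (λ _ → false))) (α-bound (λ _ → false) (λ _ _ _ _ ()))

  all-colours-seen-impossible : ∀ {c} → Proper H c → Large c → ∀ {v} → ¬ (∀ i → Sees H c v i)
  all-colours-seen-impossible {c} proper large {v} sees =
    degree-count-contradiction {α} {d} {g} {ℕ→ℚ n} {ℕ→ℚ (σ 0F)} {ℕ→ℚ (σ 1F)} {ℕ→ℚ (σ 2F)} {ℕ→ℚ μ}
                               {ℕ→ℚ (maxCodegree H)} {ℕ→ℚ D}
      0<g d>1/12 d>K (ℕ→ℚ-nonNeg μ) n≡ large maxCodegree≤αn degrees counted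
    where
    w w' : Fin 3 → Fin n
    w i = proj₁ (sees i)
    w' i = proj₁ (proj₂ (sees i))
    open Witnesses H K4⁻-free F5-free proper {v} {w} {w'} (λ i → proj₁ (proj₂ (proj₂ (sees i))))
                                                          (λ i → proj₂ (proj₂ (proj₂ (sees i))))
    σ : Fin 3 → ℕ
    σ = classSize c
    μ : ℕ
    μ = uncoloured c
    D : ℕ
    D = degree H v ℕ.+ ∑[ l < 3 ] degree H (w l)
    n≡ : ℕ→ℚ n ≡ ℕ→ℚ (σ 0F) + ℕ→ℚ (σ 1F) + ℕ→ℚ (σ 2F) + ℕ→ℚ μ
    n≡ = trans (cong ℕ→ℚ (n≡classSizes+uncoloured c))
           (trans (ℕ→ℚ-+ (σ 0F ℕ.+ σ 1F ℕ.+ σ 2F) μ) (cong (_+ ℕ→ℚ μ)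
             (trans (ℕ→ℚ-+ (σ 0F ℕ.+ σ 1F) (σ 2F)) (cong (_+ ℕ→ℚ (σ 2F)) (ℕ→ℚ-+ (σ 0F) (σ 1F))))))
    degrees : + 4 / 1 * (d * (ℕ→ℚ n * ℕ→ℚ n)) ≤ ℕ→ℚ D
    degrees = ℕ→ℚ-∑-lower (λ i → degree H ((v Vector.∷ w) i)) (λ i → <⇒≤ (δ-bound ((v Vector.∷ w) i)))
    counted : ℕ→ℚ D + ℕ→ℚ D
              ≤ pairSum (ℕ→ℚ (σ 0F)) (ℕ→ℚ (σ 1F)) (ℕ→ℚ (σ 2F)) + + 8 / 1 * (ℕ→ℚ μ * ℕ→ℚ (maxCodegree H))
    counted = subst₂ _≤_ (ℕ→ℚ-+ D D)
      (trans (ℕ→ℚ-+ (bichromaticPairs c) (8 ℕ.* (μ ℕ.* maxCodegree H)))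
             (cong₂ _+_ (ℕ→ℚ-pairSum (σ 0F) (σ 1F) (σ 2F))
                        (trans (ℕ→ℚ-* 8 (μ ℕ.* maxCodegree H))
                               (cong (+ 8 / 1 *_) (ℕ→ℚ-* μ (maxCodegree H))))))
      (ℕ→ℚ-mono-≤ degree-sum≤)

  sees? : ∀ c v i → Dec (Sees H c v i)
  sees? c v i = any? λ u → any? λ u' →
    Maybe.≡-dec Fin._≟_ (c u) (just i) ×-dec (E H v u u' Bool.≟ true)

  unseen-colour : ∀ {c} → Proper H c → Large c → ∀ v → ∃[ i ] ¬ Sees H c v i
  unseen-colour {c} proper large v =
    ¬∀⟶∃¬ 3 (Sees H c v) (sees? c v) (all-colours-seen-impossible proper large)

  colour-vertex : ∀ {c} → Good c → ∀ v → ∃[ c' ] Good c' × c ⊑ c' × IsColoured c' v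
  colour-vertex {c} (proper , large) v = extend (c v) refl
    where
    extend : ∀ m → c v ≡ m → ∃[ c' ] Good c' × c ⊑ c' × IsColoured c' v
    extend (just i) cv = c , (proper , large) , (λ cu≡j → cu≡j) , i , cv
    extend nothing  cv = recolour c v i
                       , (recolour-proper H proper unseen , ⊑-large {c} {recolour c v i} extends large)
                       , extends , i , recolour-at c v i
      where
      i : Fin 3
      i = proj₁ (unseen-colour proper large v)
      unseen : ¬ Sees H c v i
      unseen = proj₂ (unseen-colour proper large v)
      extends : c ⊑ recolour c v i
      extends = recolour-extends {c = c} {v} i cv

  colour-all : ∀ {c} → Good c → ∀ vs → ∃[ c' ] Good c' × All (IsColoured c') vs
  colour-all good [] = _ , good , []
  colour-all good (v ∷ vs) =
    let c₁ , good₁ , done = colour-all good vs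
        c₂ , good₂ , c₁⊑c₂ , v-coloured = colour-vertex good₁ v
    in c₂ , good₂ , v-coloured ∷ All.map (λ (i , c₁u≡i) → i , c₁⊑c₂ c₁u≡i) done

  three-partite : ∀ {c} → Good c → ThreePartite H
  three-partite good =
    let c , (proper , _) , coloured = colour-all good (allFin n)
    in proper-total⇒ThreePartite H proper (λ u → All.lookup coloured (∈-allFin u))

-- Only γ > 0, δ > 1/12 and δ > (1 − γ)²/12 + γα are used.
lemma5p1 : (a b d g : ℚ) →
    0ℚ < a → 0ℚ < b → 0ℚ < d → 0ℚ < g →
    ½ < b →
    ((b * (1ℚ - b)) * (+ 1 / 3) + g * a) ⊔ (((1ℚ - g) * (1ℚ - g)) * (+ 1 / 12) + g * a) ⊔ (+ 1 / 12) < d →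
    ½ * ((((+ 2 / 1 - + 2 / 1 * b) * (+ 2 / 1 - + 2 / 1 * b)) * (+ 1 / 4) + (+ 2 / 1 * b - 1ℚ) * g)
         ⊔ ((b * b) * (+ 1 / 4) + (1ℚ - b) * g)) < d →
    (n : ℕ) (H : 3Graph n) →
    ¬ ContainsK4⁻ H → ¬ ContainsF5 H →
    (∀ (I : Fin n → Bool) → Independent H I → ℕ→ℚ (count I) ≤ a * ℕ→ℚ n) →
    (∀ (v : Fin n) → d * (ℕ→ℚ n * ℕ→ℚ n) < ℕ→ℚ (degree H v)) →
    (U₁ U₂ U₃ : Fin n → Bool) →
    Independent H U₁ → Independent H U₂ → Independent H U₃ →
    Disjoint U₁ U₂ → Disjoint U₁ U₃ → Disjoint U₂ U₃ →
    b * ℕ→ℚ n < ℕ→ℚ (count U₁) + ℕ→ℚ (count U₂) →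
    b * ℕ→ℚ n < ℕ→ℚ (count U₁) + ℕ→ℚ (count U₃) →
    b * ℕ→ℚ n < ℕ→ℚ (count U₂) + ℕ→ℚ (count U₃) →
    (1ℚ - g) * ℕ→ℚ n < ℕ→ℚ (count U₁) + ℕ→ℚ (count U₂) + ℕ→ℚ (count U₃) →
    ThreePartite H
lemma5p1 a b d g _ _ _ 0<g _ d>max _ n H K4⁻-free F5-free α-bound δ-bound
         U₁ U₂ U₃ i₁ i₂ i₃ d₁₂ d₁₃ d₂₃ _ _ _ large =
  three-partite (fromClasses-proper H U independent , large-⊇ U (fromClasses-complete U d₁₂ d₁₃ d₂₃) large)
  where
  X K : ℚ
  X = (b * (1ℚ - b)) * (+ 1 / 3) + g * a
  K = ((1ℚ - g) * (1ℚ - g)) * (+ 1 / 12) + g * a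
  d>1/12 : + 1 / 12 < d
  d>1/12 = ≤-<-trans (p≤q⊔p (X ⊔ K) (+ 1 / 12)) d>max
  d>K : K < d
  d>K = ≤-<-trans (≤-trans (p≤q⊔p X K) (p≤p⊔q (X ⊔ K) (+ 1 / 12))) d>max
  open Greedy H K4⁻-free F5-free 0<g d>1/12 d>K α-bound δ-bound
  U : Fin 3 → Fin n → Bool
  U 0F = U₁
  U 1F = U₂
  U 2F = U₃
  independent : ∀ i → Independent H (U i)
  independent 0F = i₁
  independent 1F = i₂
  independent 2F = i₃
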